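{- Let $P$ be a multi-directed animal. Then the positive integer $k$ and the directed animals $A_1,\dots,A_k$ witnessing that $P$ is a multi-directed animal are unique. Namely, $k$ equals the number of source cells of $P$; and if $c_1,c_2,\dots,c_k$ are the source cells of $P$ listed from left to right, then for each $j\in\{1,\dots,k\}$, $A_j$ is the largest directed animal contained in $P\setminus(A_1\cup\dots\cup A_{j-1})$ whose source cell is $c_j$.
   Context: Work in the regular hexagonal tiling of the plane, oriented so that every hexagonal cell has two horizontal edges; thus each cell has an upper, a lower, an upper-left, an upper-right, a lower-left and a lower-right neighbour. A polyomino is a union of finitely many cells whose interior is connected. A cell $c$ is a generalized upper neighbour of a cell $d$ if $c$ is the upper-left, upper, or upper-right neighbour of $d$. Directed animals are defined recursively: a single cell is a directed animal; a union $B$ of $n\ge 2$ cells is a directed animal iff $B=A\cup c$ where $A$ is a directed animal with $n-1$ cells and $c$ is a generalized upper neighbour of some cell of $A$. In a directed animal $A$ there is exactly one cell that is not a generalized upper neighbour of any cell of $A$; it is the source cell of $A$. A cell $c$ dominates over a cell $d$ if, for some integer $i\ge 0$, $c$ is obtained from a generalized upper neighbour of $d$ by translating it vertically upward by $i$ cell heights (i.e. $c$ lies $i$ units above a generalized upper neighbour of $d$). A cell $c$ of a polyomino $P$ is a source cell of $P$ if $c$ does not dominate over any cell of $P$. If $P,Q$ are polyominoes (or unions of cells) with no common cell, $P$ dominates over $Q$ if some cell of $P$ dominates over some cell of $Q$, but no cell of $Q$ dominates over any cell of $P$. A polyomino $P$ is a multi-directed animal if there exist $k\in\mathbb{N}$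 and directed animals $A_1,\dots,A_k$, pairwise without common cells, such that: (1) $P=\bigcup_{i=1}^k A_i$; (2) for each $j\in\{2,\dots,k\}$, the horizontal projection of the source cell of $A_{j-1}$ lies to the left of (and does not intersect) the horizontal projection of $A_j$; (3) for each $j\in\{2,\dots,k\}$, the union $\bigcup_{i=1}^{j-1}A_i$ dominates over $A_j$; (4) for each $j\in\{2,\dots,k\}$, the union $\bigcup_{i=1}^{j-1}A_i$ and $A_j$ have at least one edge in common. -}

module Defs where

open import Data.Nat as ℕ using (ℕ; suc)
open import Data.Integer as ℤ using (ℤ; +_; _+_; _-_; _*_)
open import Data.Product using (Σ; ∃; ∃-syntax; _×_; _,_; proj₁; proj₂)
open import Data.Sum using (_⊎_)
open import Data.List using (List; []; _∷_; length; lookup)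
open import Data.List.Membership.Propositional using (_∈_; _∉_)
open import Data.List.Relation.Unary.AllPairs using (AllPairs)
open import Data.Fin using (fromℕ<)
open import Relation.Binary.PropositionalEquality using (_≡_; _≢_)
open import Relation.Nullary using (¬_)
open import Function.Bundles using (_⇔_)

-- Cells of the hexagonal tiling (hexagons with two horizontal edges).
--
-- We use axial coordinates: the cell (x , h) lies in column x (columns
-- are the vertical stacks of cells; consecutive columns are adjacent),
-- and its centre has height (2h + x) half-cell-heights, i.e. centre
--   ( 3x/2 , (2h + x)/2 · cellheight )   (side length 1).
-- Then the six neighbours of (x , h) are
--   upper        (x     , h + 1)      lower        (x     , h - 1)
--   upper-left   (x - 1 , h + 1)      lower-left   (x - 1 , h    )
--   upper-right  (x + 1 , h    )      lower-right  (x + 1 , h - 1)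
-- and translating a cell vertically upward by one cell height maps
-- (x , h) to (x , h + 1).

Cell : Set
Cell = ℤ × ℤ

col : Cell → ℤ
col = proj₁

up upLeft upRight : Cell → Cell
up      (x , h) = (x , h + + 1)
upLeft  (x , h) = (x - + 1 , h + + 1)
upRight (x , h) = (x + + 1 , h)

GUN : Cell → Cell → Set
GUN c d = (c ≡ up d ⊎ c ≡ upLeft d) ⊎ c ≡ upRight d

Adjacent : Cell → Cell → Set
Adjacent c d = GUN c d ⊎ GUN d c

shiftUp : ℕ → Cell → Cell
shiftUp i (x , h) = (x , h + + i)

Dominates : Cell → Cell → Set
Dominates c d = ∃[ i ] ∃[ g ] (GUN g d × c ≡ shiftUp i g)

-- Finite unions of cells are represented by lists of cells, read as
-- sets (only membership matters).

data Reach (P : List Cell) (c : Cell) : Cell → Set where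
  here : c ∈ P → Reach P c c
  step : ∀ {e d} → Reach P c e → Adjacent e d → d ∈ P → Reach P c d

-- Polyomino: a nonempty finite union of cells with connected interior
-- (in the hexagonal tiling, interior-connectedness is connectedness
-- via shared edges).
Polyomino : List Cell → Set
Polyomino P = (∃[ c ] c ∈ P) × (∀ c d → c ∈ P → d ∈ P → Reach P c d)

-- Directed animals, following the recursive definition: DA L means the
-- set of cells of L (listed with the most recently added cell first)
-- is a directed animal built in that order.
data DA : List Cell → Set where
  single : ∀ c → DA (c ∷ [])
  grow   : ∀ {A} c → DA A → c ∉ A → (∃[ d ] (d ∈ A × GUN c d)) → DA (c ∷ A)

IsDirectedAnimal : List Cell → Set
IsDirectedAnimal B = ∃[ L ] (DA L × (∀ c → (c ∈ L) ⇔ (c ∈ B)))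

DASource : List Cell → Cell → Set
DASource A c = c ∈ A × (∀ d → d ∈ A → ¬ GUN c d)

IsSourceOf : List Cell → Cell → Set
IsSourceOf P c = c ∈ P × (∀ d → d ∈ P → ¬ Dominates c d)

SetDominates : (Cell → Set) → (Cell → Set) → Set
SetDominates P Q =
  (∃[ c ] ∃[ d ] (P c × Q d × Dominates c d)) ×
  (∀ c d → Q c → P d → ¬ Dominates c d)

-- Horizontal projection of a cell in column x, in units of half the
-- side length: the closed interval [3x - 2 , 3x + 2].
hLeft hRight : Cell → ℤ
hLeft  c = + 3 * col c - + 2
hRight c = + 3 * col c + + 2

-- Multi-directed animals.  The directed animals A_1,…,A_k are given as
-- A 0, …, A (k-1) (values A i for i ≥ k are irrelevant).

-- cells of A_1 ∪ … ∪ A_j  (0-based: A 0 … A (j-1)), i.e. the first j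
InPrefix : (ℕ → List Cell) → ℕ → Cell → Set
InPrefix A j c = ∃[ i ] (i ℕ.< j × c ∈ A i)

IsMDAWitness : List Cell → (k : ℕ) → (ℕ → List Cell) → Set
IsMDAWitness P k A =
  (∀ i → i ℕ.< k → IsDirectedAnimal (A i)) ×
  (∀ i j c → i ℕ.< k → j ℕ.< k → i ≢ j → c ∈ A i → c ∉ A j) ×
  -- (1) P is their union
  (∀ c → (c ∈ P) ⇔ InPrefix A k c) ×
  -- (2) projection of the source of A_{j-1} is strictly left of that of A_j
  (∀ j s d → suc j ℕ.< k → DASource (A j) s → d ∈ A (suc j) →
     hRight s ℤ.< hLeft d) ×
  -- (3) A_1 ∪ … ∪ A_{j-1} dominates over A_j
  (∀ j → suc j ℕ.< k → SetDominates (InPrefix A (suc j)) (λ c → c ∈ A (suc j))) ×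
  -- (4) A_1 ∪ … ∪ A_{j-1} and A_j share an edge
  (∀ j → suc j ℕ.< k →
     ∃[ c ] ∃[ d ] (InPrefix A (suc j) c × d ∈ A (suc j) × Adjacent c d))

IsMultiDirectedAnimal : List Cell → Set
IsMultiDirectedAnimal P = Polyomino P × ∃[ k ] ∃[ A ] IsMDAWitness P k A

SourcesLeftToRight : List Cell → List Cell → Set
SourcesLeftToRight P cs =
  AllPairs (λ a b → col a ℤ.< col b) cs × (∀ c → (c ∈ cs) ⇔ IsSourceOf P c)

-- cells of P \ (A_1 ∪ … ∪ A_j)   (0-based: minus A 0 … A (j-1))
InRest : List Cell → (ℕ → List Cell) → ℕ → Cell → Set
InRest P A j c = c ∈ P × ¬ InPrefix A j c

LargestDAWithSource : (Cell → Set) → Cell → List Cell → Set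
LargestDAWithSource S c B =
  IsDirectedAnimal B × (∀ d → d ∈ B → S d) × DASource B c ×
  (∀ B' → IsDirectedAnimal B' → (∀ d → d ∈ B' → S d) → DASource B' c →
     ∀ d → d ∈ B' → d ∈ B)

-- A generalized upper neighbour of a cell lies higher than it, and so does every cell dominating over it; hence
-- the source of a directed animal is its unique lowest cell and dominates over none of its cells.  The source of
-- A_j does not dominate over earlier animals by (3), nor over later ones, because (2) puts every later animal at
-- least two columns to the right while a cell only dominates over cells at most one column to its right.  Every
-- other cell of P lies directly above a cell of its own animal, hence is no source.  So the sources of P are the
-- sources of A_1, …, A_k, which (2) lists from left to right.  For maximality, a cell of P outside
-- A_1 ∪ … ∪ A_{j-1} lying directly above a cell of A_j belongs to A_j, since otherwise a later animal would
-- dominate over A_j, against (3); hence a directed animal grown inside that region from the source of A_j never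
-- leaves A_j.
module Submission where

open import Defs
open import Data.Nat using (ℕ; _<_)
open import Data.List using (List; length; lookup)
open import Data.Fin using (fromℕ<)
open import Data.Product using (Σ; _×_)
open import Relation.Binary.PropositionalEquality using (_≡_)

open import Data.Nat as ℕ using (suc; s≤s; z≤n; _<?_)
import Data.Nat.Properties as ℕ
open import Data.Integer as ℤ using (ℤ; +_; +<+; +≤+; _+_; _-_; _*_; -_; _≤_)
import Data.Integer.Properties as ℤ
open import Data.Integer.Tactic.RingSolver using (solve-∀)
open import Data.Fin.Properties using (toℕ-fromℕ<)
open import Data.Product using (∃-syntax; _,_; proj₁; proj₂)
open import Data.Sum using (_⊎_; inj₁; inj₂)
open import Data.Empty using (⊥-elim)
open import Data.List using ([]; _∷_; applyUpTo)
open import Data.List.Properties using (length-applyUpTo; lookup-applyUpTo)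
open import Data.List.Membership.Propositional using (_∈_; _∉_)
open import Data.List.Membership.Propositional.Properties using (∈-applyUpTo⁺; ∈-applyUpTo⁻)
open import Data.List.Relation.Unary.Any using (here; there)
open import Data.List.Relation.Unary.All as All using (All)
open import Data.List.Relation.Unary.AllPairs using (AllPairs; []; _∷_)
open import Data.List.Relation.Unary.AllPairs.Properties using (applyUpTo⁺₁)
open import Data.List.Relation.Binary.Subset.Propositional using (_⊆_)
open import Relation.Binary.Core using (Rel)
open import Relation.Binary.Definitions using (Irreflexive; Transitive; tri<; tri≈; tri>)
open import Relation.Binary.PropositionalEquality using (_≢_; refl; sym; trans; cong; cong₂; subst)
open import Relation.Nullary using (¬_; yes; no; contradiction)
open import Function.Bundles using (_⇔_; Equivalence)
open Equivalence using (to; from)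

module _ {a r} {X : Set a} {R : Rel X r} (irrefl : Irreflexive _≡_ R) (R-trans : Transitive R) where

  private
    ∷⊆∷⇒⊆ : ∀ {x y xs ys} → x ≡ y → All (R x) xs → x ∷ xs ⊆ y ∷ ys → xs ⊆ ys
    ∷⊆∷⇒⊆ refl x<xs xxs⊆yys z∈xs with xxs⊆yys (there z∈xs)
    ... | here refl  = ⊥-elim (irrefl refl (All.lookup x<xs z∈xs))
    ... | there z∈ys = z∈ys

  AllPairs-⊆-⊇⇒≡ : ∀ {xs ys} → AllPairs R xs → AllPairs R ys → xs ⊆ ys → ys ⊆ xs → xs ≡ ys
  AllPairs-⊆-⊇⇒≡ [] [] _ _ = refl
  AllPairs-⊆-⊇⇒≡ [] (_ ∷ _) _ ys⊆[] with ys⊆[] (here refl)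
  ... | ()
  AllPairs-⊆-⊇⇒≡ (_ ∷ _) [] xs⊆[] _ with xs⊆[] (here refl)
  ... | ()
  AllPairs-⊆-⊇⇒≡ {x ∷ xs} {y ∷ ys} (x<xs ∷ sorted-xs) (y<ys ∷ sorted-ys) xxs⊆yys yys⊆xxs =
    cong₂ _∷_ x≡y (AllPairs-⊆-⊇⇒≡ sorted-xs sorted-ys
      (∷⊆∷⇒⊆ x≡y x<xs xxs⊆yys) (∷⊆∷⇒⊆ (sym x≡y) y<ys yys⊆xxs))
    where
    x≡y : x ≡ y
    x≡y with xxs⊆yys (here refl) | yys⊆xxs (here refl)
    ... | here x≡y   | _          = x≡y
    ... | there _    | here y≡x   = sym y≡x
    ... | there x∈ys | there y∈xs =
      ⊥-elim (irrefl refl (R-trans (All.lookup x<xs y∈xs) (All.lookup y<ys x∈ys)))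

lookup-applyUpTo-fromℕ< : ∀ {a} {X : Set a} (f : ℕ → X) n {j} (p : j < length (applyUpTo f n)) →
  lookup (applyUpTo f n) (fromℕ< p) ≡ f j
lookup-applyUpTo-fromℕ< f n p = trans (lookup-applyUpTo f n (fromℕ< p)) (cong f (toℕ-fromℕ< p))

height : Cell → ℤ
height (x , h) = h + h + x

height-up : ∀ c → height (up c) ≡ height c + + 2
height-up (x , h) = identity x h
  where
  identity : ∀ x h → (h + + 1) + (h + + 1) + x ≡ (h + h + x) + + 2
  identity = solve-∀

height-upLeft : ∀ c → height (upLeft c) ≡ height c + + 1
height-upLeft (x , h) = identity x h
  where
  identity : ∀ x h → (h + + 1) + (h + + 1) + (x - + 1) ≡ (h + h + x) + + 1
  identity = solve-∀

height-upRight : ∀ c → height (upRight c) ≡ height c + + 1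
height-upRight (x , h) = identity x h
  where
  identity : ∀ x h → h + h + (x + + 1) ≡ (h + h + x) + + 1
  identity = solve-∀

height-shiftUp : ∀ i c → height (shiftUp i c) ≡ height c + (+ i + + i)
height-shiftUp i (x , h) = identity x h (+ i)
  where
  identity : ∀ x h j → (h + j) + (h + j) + x ≡ (h + h + x) + (j + j)
  identity = solve-∀

i<i+[1+n] : ∀ i n → i ℤ.< i + + suc n
i<i+[1+n] i n = subst (ℤ._< i + + suc n) (ℤ.+-identityʳ i) (ℤ.+-monoʳ-< i (+<+ (s≤s z≤n)))

GUN⇒height< : ∀ {c d} → GUN c d → height d ℤ.< height c
GUN⇒height< {d = d} (inj₁ (inj₁ refl)) = subst (height d ℤ.<_) (sym (height-up d)) (i<i+[1+n] _ 1)
GUN⇒height< {d = d} (inj₁ (inj₂ refl)) = subst (height d ℤ.<_) (sym (height-upLeft d)) (i<i+[1+n] _ 0)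
GUN⇒height< {d = d} (inj₂ refl)        = subst (height d ℤ.<_) (sym (height-upRight d)) (i<i+[1+n] _ 0)

Dominates⇒height< : ∀ {c d} → Dominates c d → height d ℤ.< height c
Dominates⇒height< (i , g , g↑d , refl) =
  ℤ.<-≤-trans (GUN⇒height< g↑d)
    (subst (height g ≤_) (sym (height-shiftUp i g)) (ℤ.i≤i+j (height g) (+ i + + i)))

GUN⇒Dominates : ∀ {c d} → GUN c d → Dominates c d
GUN⇒Dominates {x , h} c↑d = 0 , (x , h) , c↑d , cong (x ,_) (sym (ℤ.+-identityʳ h))

_≪_ : Cell → Cell → Set
c ≪ d = col c + + 1 ℤ.< col d

≪-trans : ∀ {a b c} → a ≪ b → b ≪ c → a ≪ c
≪-trans {b = b} a≪b b≪c = ℤ.<-trans a≪b (ℤ.≤-<-trans (ℤ.i≤i+j (col b) (+ 1)) b≪c)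

≪⇒col< : ∀ {a b} → a ≪ b → col a ℤ.< col b
≪⇒col< {a} a≪b = ℤ.≤-<-trans (ℤ.i≤i+j (col a) (+ 1)) a≪b

hRight<hLeft⇒≪ : ∀ {a b} → hRight a ℤ.< hLeft b → a ≪ b
hRight<hLeft⇒≪ {a} {b} separated = ℤ.≰⇒> λ b≤a+1 → ℤ.<⇒≱ separated (hLeft≤hRight b≤a+1)
  where
  identity : ∀ x → + 3 * (x + + 1) - + 2 ≡ + 3 * x + + 1
  identity = solve-∀
  hLeft≤hRight : col b ≤ col a + + 1 → hLeft b ≤ hRight a
  hLeft≤hRight b≤a+1 = begin
    + 3 * col b - + 2         ≤⟨ ℤ.+-monoˡ-≤ (- + 2) (ℤ.*-monoˡ-≤-nonNeg (+ 3) b≤a+1) ⟩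
    + 3 * (col a + + 1) - + 2 ≡⟨ identity (col a) ⟩
    + 3 * col a + + 1         ≤⟨ ℤ.+-monoʳ-≤ (+ 3 * col a) (+≤+ (s≤s z≤n)) ⟩
    + 3 * col a + + 2         ∎
    where open ℤ.≤-Reasoning

GUN⇒col≤col+1 : ∀ {c d} → GUN c d → col d ≤ col c + + 1
GUN⇒col≤col+1 {d = x , _} (inj₁ (inj₁ refl)) = ℤ.i≤i+j x (+ 1)
GUN⇒col≤col+1 {d = x , _} (inj₁ (inj₂ refl)) = ℤ.≤-reflexive (identity x)
  where
  identity : ∀ x → x ≡ (x - + 1) + + 1
  identity = solve-∀
GUN⇒col≤col+1 {d = x , _} (inj₂ refl) = ℤ.≤-trans (ℤ.i≤i+j x (+ 2)) (ℤ.≤-reflexive (identity x))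
  where
  identity : ∀ x → x + + 2 ≡ (x + + 1) + + 1
  identity = solve-∀

Dominates⇒¬≪ : ∀ {c d} → Dominates c d → ¬ c ≪ d
Dominates⇒¬≪ (_ , (_ , _) , g↑d , refl) c≪d = ℤ.<⇒≱ c≪d (GUN⇒col≤col+1 g↑d)

source : ∀ {L} → DA L → Cell
source (single c)     = c
source (grow _ D _ _) = source D

source∈ : ∀ {L} (D : DA L) → source D ∈ L
source∈ (single _)     = here refl
source∈ (grow _ D _ _) = there (source∈ D)

∈⇒≡source⊎GUN : ∀ {L c} (D : DA L) → c ∈ L → c ≡ source D ⊎ ∃[ d ] (d ∈ L × GUN c d)
∈⇒≡source⊎GUN (single _)                    (here refl) = inj₁ refl
∈⇒≡source⊎GUN (grow _ _ _ (d , d∈L , c↑d)) (here refl) = inj₂ (d , there d∈L , c↑d)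
∈⇒≡source⊎GUN (grow _ D _ _)                (there c∈L) with ∈⇒≡source⊎GUN D c∈L
... | inj₁ c≡s               = inj₁ c≡s
... | inj₂ (d , d∈L , c↑d) = inj₂ (d , there d∈L , c↑d)

height-source≤ : ∀ {L c} (D : DA L) → c ∈ L → height (source D) ≤ height c
height-source≤ (single _) (here refl) = ℤ.≤-refl
height-source≤ (grow _ D _ (d , d∈L , c↑d)) (here refl) =
  ℤ.≤-trans (height-source≤ D d∈L) (ℤ.<⇒≤ (GUN⇒height< c↑d))
height-source≤ (grow _ D _ _) (there c∈L) = height-source≤ D c∈L

source-¬Dominates : ∀ {L d} (D : DA L) → d ∈ L → ¬ Dominates (source D) d
source-¬Dominates D d∈L s≻d =
  ℤ.<-irrefl refl (ℤ.≤-<-trans (height-source≤ D d∈L) (Dominates⇒height< s≻d))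

DA-⊆-upClosed : ∀ {L} {S X : Cell → Set} → (∀ {c d} → S c → X d → GUN c d → X c) →
  (D : DA L) → (∀ {c} → c ∈ L → S c) → X (source D) → ∀ {c} → c ∈ L → X c
DA-⊆-upClosed closed (single _) _ s∈X (here refl) = s∈X
DA-⊆-upClosed closed (grow _ D _ (d , d∈L , c↑d)) L⊆S s∈X (here refl) =
  closed (L⊆S (here refl)) (DA-⊆-upClosed closed D (λ e∈L → L⊆S (there e∈L)) s∈X d∈L) c↑d
DA-⊆-upClosed closed (grow _ D _ _) L⊆S s∈X (there c∈L) =
  DA-⊆-upClosed closed D (λ e∈L → L⊆S (there e∈L)) s∈X c∈L

sourceOf : ∀ {B} → IsDirectedAnimal B → Cell
sourceOf (_ , D , _) = source D

sourceOf-DASource : ∀ {B} (D : IsDirectedAnimal B) → DASource B (sourceOf D)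
sourceOf-DASource (_ , D , L⇔B) =
  to (L⇔B _) (source∈ D) ,
  λ d d∈B s↑d → source-¬Dominates D (from (L⇔B d) d∈B) (GUN⇒Dominates s↑d)

DASource⇒≡sourceOf : ∀ {B c} (D : IsDirectedAnimal B) → DASource B c → c ≡ sourceOf D
DASource⇒≡sourceOf (_ , D , L⇔B) (c∈B , c↑̸B) with ∈⇒≡source⊎GUN D (from (L⇔B _) c∈B)
... | inj₁ c≡s             = c≡s
... | inj₂ (d , d∈L , c↑d) = ⊥-elim (c↑̸B d (to (L⇔B d) d∈L) c↑d)

DASource-unique : ∀ {B c c′} → IsDirectedAnimal B → DASource B c → DASource B c′ → c ≡ c′
DASource-unique D s s′ = trans (DASource⇒≡sourceOf D s) (sym (DASource⇒≡sourceOf D s′))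

∈⇒DASource⊎GUN : ∀ {B c} (D : IsDirectedAnimal B) → c ∈ B → DASource B c ⊎ ∃[ d ] (d ∈ B × GUN c d)
∈⇒DASource⊎GUN D@(_ , D′ , L⇔B) c∈B with ∈⇒≡source⊎GUN D′ (from (L⇔B _) c∈B)
... | inj₁ refl            = inj₁ (sourceOf-DASource D)
... | inj₂ (d , d∈L , c↑d) = inj₂ (d , to (L⇔B d) d∈L , c↑d)

DASource-¬Dominates : ∀ {B c d} → IsDirectedAnimal B → DASource B c → d ∈ B → ¬ Dominates c d
DASource-¬Dominates {d = d} D@(_ , D′ , L⇔B) s d∈B =
  subst (λ c → ¬ Dominates c d) (sym (DASource⇒≡sourceOf D s)) (source-¬Dominates D′ (from (L⇔B d) d∈B))

directedAnimal-⊆-upClosed : ∀ {B c} {S X : Cell → Set} → (∀ {c d} → S c → X d → GUN c d → X c) →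
  IsDirectedAnimal B → (∀ d → d ∈ B → S d) → DASource B c → X c → ∀ d → d ∈ B → X d
directedAnimal-⊆-upClosed {X = X} closed D@(_ , D′ , L⇔B) B⊆S s c∈X d d∈B =
  DA-⊆-upClosed closed D′ (λ {e} e∈L → B⊆S e (to (L⇔B e) e∈L))
    (subst X (DASource⇒≡sourceOf D s) c∈X) (from (L⇔B d) d∈B)

module MultiDirectedAnimal {P : List Cell} {k : ℕ} {A : ℕ → List Cell} (W : IsMDAWitness P k A) where

  isDA : ∀ i → i < k → IsDirectedAnimal (A i)
  isDA = proj₁ W

  disjoint : ∀ i j c → i < k → j < k → i ≢ j → c ∈ A i → c ∉ A j
  disjoint = proj₁ (proj₂ W)

  covers : ∀ c → (c ∈ P) ⇔ InPrefix A k c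
  covers = proj₁ (proj₂ (proj₂ W))

  separated : ∀ j s d → suc j < k → DASource (A j) s → d ∈ A (suc j) → hRight s ℤ.< hLeft d
  separated = proj₁ (proj₂ (proj₂ (proj₂ W)))

  dominance : ∀ j → suc j < k → SetDominates (InPrefix A (suc j)) (λ c → c ∈ A (suc j))
  dominance = proj₁ (proj₂ (proj₂ (proj₂ (proj₂ W))))

  ∈A⇒∈P : ∀ {i c} → i < k → c ∈ A i → c ∈ P
  ∈A⇒∈P i<k c∈Ai = from (covers _) (_ , i<k , c∈Ai)

  -- Junk value for j ≥ k.
  src : ℕ → Cell
  src j with j <? k
  ... | yes j<k = sourceOf (isDA j j<k)
  ... | no _    = + 0 , + 0

  src-DASource : ∀ {j} → j < k → DASource (A j) (src j)
  src-DASource {j} j<k with j <? k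
  ... | yes j<k′ = sourceOf-DASource (isDA j j<k′)
  ... | no j≮k   = contradiction j<k j≮k

  src∈A : ∀ {j} → j < k → src j ∈ A j
  src∈A j<k = proj₁ (src-DASource j<k)

  ¬Dominates-earlier : ∀ {i j c d} → i < j → j < k → c ∈ A j → d ∈ A i → ¬ Dominates c d
  ¬Dominates-earlier {i} {suc j} i<1+j 1+j<k c∈Aj d∈Ai =
    proj₂ (dominance j 1+j<k) _ _ c∈Aj (i , i<1+j , d∈Ai)

  src≪next : ∀ {m d} → suc m < k → d ∈ A (suc m) → src m ≪ d
  src≪next {m} {d} 1+m<k d∈ = hRight<hLeft⇒≪ {src m} {d} (separated m (src m) d 1+m<k (src-DASource (ℕ.<⇒≤ 1+m<k)) d∈)

  src≪later : ∀ {i m d} → i < m → m < k → d ∈ A m → src i ≪ d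
  src≪later {i} {suc m} {d} i<1+m 1+m<k d∈ with ℕ.m<1+n⇒m<n∨m≡n i<1+m
  ... | inj₂ refl = src≪next 1+m<k d∈
  ... | inj₁ i<m  = ≪-trans {src i} {src m} {d} (src≪later i<m m<k (src∈A m<k)) (src≪next 1+m<k d∈)
    where
    m<k : m < k
    m<k = ℕ.<⇒≤ 1+m<k

  src-IsSourceOf : ∀ {j} → j < k → IsSourceOf P (src j)
  src-IsSourceOf {j} j<k = ∈A⇒∈P j<k (src∈A j<k) , λ d d∈P → ¬dominated (to (covers d) d∈P)
    where
    ¬dominated : ∀ {d} → InPrefix A k d → ¬ Dominates (src j) d
    ¬dominated (m , m<k , d∈Am) with ℕ.<-cmp m j
    ... | tri< m<j _ _  = ¬Dominates-earlier m<j j<k (src∈A j<k) d∈Am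
    ... | tri≈ _ refl _ = DASource-¬Dominates (isDA j j<k) (src-DASource j<k) d∈Am
    ... | tri> _ _ j<m  = λ src≻d → Dominates⇒¬≪ src≻d (src≪later j<m m<k d∈Am)

  IsSourceOf⇒≡src : ∀ {c} → IsSourceOf P c → ∃[ j ] (j < k × c ≡ src j)
  IsSourceOf⇒≡src (c∈P , c⊁P) with to (covers _) c∈P
  ... | i , i<k , c∈Ai with ∈⇒DASource⊎GUN (isDA i i<k) c∈Ai
  ...   | inj₁ s               = i , i<k , DASource-unique (isDA i i<k) s (src-DASource i<k)
  ...   | inj₂ (d , d∈Ai , c↑d) = ⊥-elim (c⊁P d (∈A⇒∈P i<k d∈Ai) (GUN⇒Dominates c↑d))

  applyUpTo-src≡ : ∀ {cs} → SourcesLeftToRight P cs → applyUpTo src k ≡ cs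
  applyUpTo-src≡ {cs} (sorted , cs⇔sources) =
    AllPairs-⊆-⊇⇒≡ (λ { refl → ℤ.<-irrefl refl }) ℤ.<-trans
      (applyUpTo⁺₁ src k (λ {i} {j} i<j j<k → ≪⇒col< {src i} {src j} (src≪later i<j j<k (src∈A j<k))))
      sorted sources⊆cs cs⊆sources
    where
    sources⊆cs : applyUpTo src k ⊆ cs
    sources⊆cs c∈ with ∈-applyUpTo⁻ src c∈
    ... | i , i<k , refl = from (cs⇔sources _) (src-IsSourceOf i<k)
    cs⊆sources : cs ⊆ applyUpTo src k
    cs⊆sources c∈ with IsSourceOf⇒≡src (to (cs⇔sources _) c∈)
    ... | j , j<k , refl = ∈-applyUpTo⁺ src j<k

  A-largest : ∀ {j} → j < k → LargestDAWithSource (InRest P A j) (src j) (A j)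
  A-largest {j} j<k = isDA j j<k , A⊆rest , src-DASource j<k , maximal
    where
    A⊆rest : ∀ d → d ∈ A j → InRest P A j d
    A⊆rest d d∈Aj =
      ∈A⇒∈P j<k d∈Aj ,
      λ { (i , i<j , d∈Ai) → disjoint i j d (ℕ.<-trans i<j j<k) j<k (ℕ.<⇒≢ i<j) d∈Ai d∈Aj }
    upClosed : ∀ {c d} → InRest P A j c → d ∈ A j → GUN c d → c ∈ A j
    upClosed (c∈P , c∉prefix) d∈Aj c↑d with to (covers _) c∈P
    ... | m , m<k , c∈Am with ℕ.<-cmp m j
    ...   | tri< m<j _ _  = contradiction (m , m<j , c∈Am) c∉prefix
    ...   | tri≈ _ refl _ = c∈Am
    ...   | tri> _ _ j<m  = contradiction (GUN⇒Dominates c↑d) (¬Dominates-earlier j<m m<k c∈Am d∈Aj)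
    maximal : ∀ B → IsDirectedAnimal B → (∀ d → d ∈ B → InRest P A j d) → DASource B (src j) →
      ∀ d → d ∈ B → d ∈ A j
    maximal _ D B⊆rest s = directedAnimal-⊆-upClosed upClosed D B⊆rest s (src∈A j<k)

mainTheorem2 : (P : List Cell) → IsMultiDirectedAnimal P →
    (k : ℕ) (A : ℕ → List Cell) → IsMDAWitness P k A →
    (cs : List Cell) → SourcesLeftToRight P cs →
    Σ (k ≡ length cs) (λ _ →
      (j : ℕ) (p : j < length cs) →
        LargestDAWithSource (InRest P A j) (lookup cs (fromℕ< p)) (A j))
mainTheorem2 P _ k A W cs sources with MultiDirectedAnimal.applyUpTo-src≡ W sources
... | refl = sym |sources|≡k , λ j p →
  subst (λ c → LargestDAWithSource (InRest P A j) c (A j))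
    (sym (lookup-applyUpTo-fromℕ< src k p)) (A-largest (subst (j <_) |sources|≡k p))
  where
  open MultiDirectedAnimal W
  |sources|≡k : length (applyUpTo src k) ≡ k
  |sources|≡k = length-applyUpTo src k
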